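{- Let $f:\{0,1\}^n\to\{0,1\}$ with $F:=f^{ -1}(1)\ne\emptyset$, $N:=|F|$; define $g_f(a)=1$ iff $\Pr_{x\sim F}[f(a\oplus x)=1]\ge 1/2$, $G:=g_f^{ -1}(1)$, and $\mathcal{X}=\{x\in G:\{y:y\preceq x\}\subseteq G\}$. Assume $G$ is a linear subspace of $\mathbb{F}_2^n$, $g_f$ is not an anti-monotone conjunction, and $\mathrm{rel}\text{ - }\mathrm{dist}(f,g_f)\le 0.1$. Then $|(G\setminus\mathcal{X})\cap F|\ge 0.1N$.
   Context: $\oplus$ is coordinatewise XOR; $y\preceq x$ means $y_i\le x_i$ for all $i$; $x\sim F$ is uniform on $F$. $\mathrm{rel}\text{ - }\mathrm{dist}(f,g)=|f^{ -1}(1)\triangle g^{ -1}(1)|/|f^{ -1}(1)|$. An anti-monotone conjunction is a conjunction of negated variables. -}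

module Defs where

open import Data.Nat using (ℕ; zero; suc; _+_; _*_; _≤ᵇ_)
open import Data.Bool using (Bool; true; false; _∧_; _∨_; _xor_; not; if_then_else_)
open import Data.List using (List; []; _∷_; map; _++_)
open import Relation.Binary.PropositionalEquality using (_≡_)
open import Data.Product using (Σ; _×_)
open import Data.Vec using (Vec; []; _∷_; zipWith; replicate)

BVec : ℕ → Set
BVec n = Vec Bool n

BoolFun : ℕ → Set
BoolFun n = BVec n → Bool

allVecs : (n : ℕ) → List (BVec n)
allVecs zero = [] ∷ []
allVecs (suc n) = map (true ∷_) (allVecs n) ++ map (false ∷_) (allVecs n)

countList : {A : Set} → (A → Bool) → List A → ℕ
countList p [] = 0
countList p (x ∷ xs) = if p x then suc (countList p xs) else countList p xs

count : {n : ℕ} → BoolFun n → ℕ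
count {n} p = countList p (allVecs n)

_⊕_ : {n : ℕ} → BVec n → BVec n → BVec n
_⊕_ = zipWith _xor_

zeroVec : {n : ℕ} → BVec n
zeroVec = replicate _ false

_≼ᵇ_ : {n : ℕ} → BVec n → BVec n → Bool
[] ≼ᵇ [] = true
(a ∷ y) ≼ᵇ (b ∷ x) = (not a ∨ b) ∧ (y ≼ᵇ x)

N : {n : ℕ} → BoolFun n → ℕ
N f = count f

-- g_f(a) = 1 iff Pr_{x ~ F}[f(a ⊕ x) = 1] ≥ 1/2,
-- i.e. iff 2 · |{x ∈ F : f(a ⊕ x) = 1}| ≥ N.
g : {n : ℕ} → BoolFun n → BoolFun n
g f a = N f ≤ᵇ (2 * count (λ x → f x ∧ f (a ⊕ x)))

inX : {n : ℕ} → BoolFun n → BoolFun n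
inX {n} G x = G x ∧ (countList (λ y → (y ≼ᵇ x) ∧ not (G y)) (allVecs n) ≤ᵇ 0)

IsLinearSubspace : {n : ℕ} → BoolFun n → Set
IsLinearSubspace {n} h =
  (h zeroVec ≡ true) ×
  ((x y : BVec n) → h x ≡ true → h y ≡ true → h (x ⊕ y) ≡ true)

negConj : {n : ℕ} → BVec n → BVec n → Bool
negConj [] [] = true
negConj (s ∷ S) (b ∷ x) = not (s ∧ b) ∧ negConj S x

IsAntiMonotoneConj : {n : ℕ} → BoolFun n → Set
IsAntiMonotoneConj {n} h = Σ (BVec n) (λ S → (x : BVec n) → h x ≡ negConj S x)

-- 𝒳 is closed under ⊕ when G is a subspace: every z ≼ x ⊕ y splits as
-- (z ∧ x) ⊕ (z ∧ y) with z ∧ x ≼ x and z ∧ y ≼ y. If G ⊆ 𝒳, then G is a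
-- down-closed subspace, hence spanned by the unit vectors it contains, hence an
-- anti-monotone conjunction; so some a ∈ G lies outside 𝒳. Since g_f(a) = 1, at
-- least N/2 points x ∈ F have a ⊕ x ∈ F. For each of them either x ∈ 𝒳, and then
-- a ⊕ x ∈ (G ∖ 𝒳) ∩ F, or x ∈ F ∖ 𝒳, and then x ∈ (G ∖ 𝒳) ∩ F or f(x) ≠ g_f(x).
-- With C = |(G ∖ 𝒳) ∩ F| and translation invariance of counting this gives
-- N/2 ≤ 2C + N/10, i.e. N ≤ 5C.
module Submission where

open import Defs
open import Data.Nat using (ℕ; zero; suc; _+_; _*_; _≤_; _≤ᵇ_; z≤n; s≤s)
open import Data.Nat.Properties
  using (≤ᵇ⇒≤; ≤-trans; ≤-reflexive; n≤0⇒n≡0; m≤n⇒m≤1+n; n≤1+n; m≤m+n; +-comm; +-suc; m+n≡0⇒m≡0; m+n≡0⇒n≡0;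
         +-mono-≤; +-monoʳ-≤; *-monoʳ-≤; *-monoˡ-≤; +-cancelʳ-≤; *-cancelˡ-≤; module ≤-Reasoning)
open import Data.Nat.Tactic.RingSolver using (solve-∀)
open import Data.Bool using (Bool; true; false; _∧_; _∨_; _xor_; not; _≟_)
open import Data.Bool.Properties
  using (∧-conicalˡ; ∧-conicalʳ; ∨-zeroʳ; not-injective; ¬-not; xor-assoc; xor-same; xor-identityˡ; xor-identityʳ; T-≡)
open import Data.Product using (Σ; _×_; _,_)
open import Data.Sum using (_⊎_; inj₁; inj₂)
open import Data.Empty using (⊥-elim)
open import Data.List using (List; []; _∷_; map; _++_)
open import Data.Vec using ([]; _∷_; lookup; tabulate; zipWith)
open import Data.Vec.Properties using (lookup∘tabulate; zipWith-identityˡ)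
open import Data.Fin using (Fin; zero; suc)
open import Function using (_∘_)
open import Function.Bundles using (Equivalence)
open import Relation.Binary.PropositionalEquality
  using (_≡_; refl; sym; trans; cong; cong₂; subst; module ≡-Reasoning)
open import Relation.Nullary using (¬_; yes; no)

private
  variable
    n : ℕ

∨-introˡ : ∀ {a} b → a ≡ true → a ∨ b ≡ true
∨-introˡ b refl = refl

∨-introʳ : ∀ a {b} → b ≡ true → a ∨ b ≡ true
∨-introʳ a refl = ∨-zeroʳ a

⇔true⇒≡ : ∀ {a b} → (a ≡ true → b ≡ true) → (b ≡ true → a ≡ true) → a ≡ b
⇔true⇒≡ {true}  {true}  _ _ = refl
⇔true⇒≡ {true}  {false} a⇒b _ = sym (a⇒b refl)
⇔true⇒≡ {false} {true}  _ b⇒a = b⇒a refl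
⇔true⇒≡ {false} {false} _ _ = refl

≤ᵇ-true⇒≤ : ∀ {m k} → (m ≤ᵇ k) ≡ true → m ≤ k
≤ᵇ-true⇒≤ {m} {k} = ≤ᵇ⇒≤ m k ∘ Equivalence.from T-≡

m≤2k∧k≤2c+e∧10e≤m⇒m≤5c : ∀ {m k c e} → m ≤ 2 * k → k ≤ c + (c + e) → 10 * e ≤ m → m ≤ 5 * c
m≤2k∧k≤2c+e∧10e≤m⇒m≤5c {m} {k} {c} {e} m≤2k k≤2c+e 10e≤m =
  *-cancelˡ-≤ 8 (+-cancelʳ-≤ (2 * m) (8 * m) (8 * (5 * c)) 10m≤40c+2m)
  where
  open ≤-Reasoning
  8m+2m≡10m : ∀ m → 8 * m + 2 * m ≡ 10 * m
  8m+2m≡10m = solve-∀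
  expand : ∀ c e → 10 * (2 * (c + (c + e))) ≡ 8 * (5 * c) + 2 * (10 * e)
  expand = solve-∀
  10m≤40c+2m : 8 * m + 2 * m ≤ 8 * (5 * c) + 2 * m
  10m≤40c+2m = begin
    8 * m + 2 * m                   ≡⟨ 8m+2m≡10m m ⟩
    10 * m                          ≤⟨ *-monoʳ-≤ 10 m≤2k ⟩
    10 * (2 * k)                    ≤⟨ *-monoʳ-≤ 10 (*-monoʳ-≤ 2 k≤2c+e) ⟩
    10 * (2 * (c + (c + e)))        ≡⟨ expand c e ⟩
    8 * (5 * c) + 2 * (10 * e)      ≤⟨ +-monoʳ-≤ (8 * (5 * c)) (*-monoʳ-≤ 2 10e≤m) ⟩
    8 * (5 * c) + 2 * m             ∎

module _ {A : Set} where

  countList-++ : (p : A → Bool) (xs ys : List A) →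
                 countList p (xs ++ ys) ≡ countList p xs + countList p ys
  countList-++ p []       ys = refl
  countList-++ p (x ∷ xs) ys with p x
  ... | true  = cong suc (countList-++ p xs ys)
  ... | false = countList-++ p xs ys

  countList-false : (p : A → Bool) → (∀ x → p x ≡ false) → (xs : List A) → countList p xs ≡ 0
  countList-false p none []       = refl
  countList-false p none (x ∷ xs) rewrite none x = countList-false p none xs

  countList-mono : (p q : A → Bool) → (∀ x → p x ≡ true → q x ≡ true) →
                   (xs : List A) → countList p xs ≤ countList q xs
  countList-mono p q p⇒q []       = z≤n
  countList-mono p q p⇒q (x ∷ xs) with p x in px | q x in qx
  ... | true  | true  = s≤s (countList-mono p q p⇒q xs)
  ... | false | true  = m≤n⇒m≤1+n (countList-mono p q p⇒q xs)
  ... | false | false = countList-mono p q p⇒q xs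
  ... | true  | false with () ← trans (sym qx) (p⇒q x px)

  countList-∨ : (p q : A → Bool) (xs : List A) →
                countList (λ x → p x ∨ q x) xs ≤ countList p xs + countList q xs
  countList-∨ p q []       = z≤n
  countList-∨ p q (x ∷ xs) with ih ← countList-∨ p q xs | p x | q x
  ... | true  | true  = s≤s (≤-trans ih (+-monoʳ-≤ (countList p xs) (n≤1+n _)))
  ... | true  | false = s≤s ih
  ... | false | true  = ≤-trans (s≤s ih) (≤-reflexive (sym (+-suc _ _)))
  ... | false | false = ih

countList-map : {A B : Set} (p : B → Bool) (h : A → B) (xs : List A) →
                countList p (map h xs) ≡ countList (p ∘ h) xs
countList-map p h []       = refl
countList-map p h (x ∷ xs) with p (h x)
... | true  = cong suc (countList-map p h xs)
... | false = countList-map p h xs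

count-split : (p : BoolFun (suc n)) → count p ≡ count (p ∘ (true ∷_)) + count (p ∘ (false ∷_))
count-split {n} p =
  trans (countList-++ p (map (true ∷_) (allVecs n)) (map (false ∷_) (allVecs n)))
        (cong₂ _+_ (countList-map p (true ∷_) (allVecs n)) (countList-map p (false ∷_) (allVecs n)))

count≡0⇒false : (p : BoolFun n) → count p ≡ 0 → ∀ y → p y ≡ false
count≡0⇒false {zero} p c≡0 [] with p [] in p[]
... | false = refl
... | true with () ← c≡0
count≡0⇒false {suc n} p c≡0 (true ∷ y) =
  count≡0⇒false (p ∘ (true ∷_)) (m+n≡0⇒m≡0 _ (trans (sym (count-split p)) c≡0)) y
count≡0⇒false {suc n} p c≡0 (false ∷ y) =
  count≡0⇒false (p ∘ (false ∷_)) (m+n≡0⇒n≡0 _ (trans (sym (count-split p)) c≡0)) y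

count-⊕-invariant : (h : BoolFun n) (a : BVec n) → count (λ x → h (a ⊕ x)) ≡ count h
count-⊕-invariant {zero}  h []        = refl
count-⊕-invariant {suc n} h (true ∷ a) = begin
  count (λ x → h ((true ∷ a) ⊕ x))
    ≡⟨ count-split (λ x → h ((true ∷ a) ⊕ x)) ⟩
  count (λ x → h (false ∷ a ⊕ x)) + count (λ x → h (true ∷ a ⊕ x))
    ≡⟨ cong₂ _+_ (count-⊕-invariant (h ∘ (false ∷_)) a) (count-⊕-invariant (h ∘ (true ∷_)) a) ⟩
  count (h ∘ (false ∷_)) + count (h ∘ (true ∷_))
    ≡⟨ +-comm (count (h ∘ (false ∷_))) _ ⟩
  count (h ∘ (true ∷_)) + count (h ∘ (false ∷_))
    ≡⟨ count-split h ⟨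
  count h
    ∎
  where open ≡-Reasoning
count-⊕-invariant {suc n} h (false ∷ a) = begin
  count (λ x → h ((false ∷ a) ⊕ x))
    ≡⟨ count-split (λ x → h ((false ∷ a) ⊕ x)) ⟩
  count (λ x → h (true ∷ a ⊕ x)) + count (λ x → h (false ∷ a ⊕ x))
    ≡⟨ cong₂ _+_ (count-⊕-invariant (h ∘ (true ∷_)) a) (count-⊕-invariant (h ∘ (false ∷_)) a) ⟩
  count (h ∘ (true ∷_)) + count (h ∘ (false ∷_))
    ≡⟨ count-split h ⟨
  count h
    ∎
  where open ≡-Reasoning

∃-true⊎∀-false : (p : BoolFun n) → Σ (BVec n) (λ x → p x ≡ true) ⊎ (∀ x → p x ≡ false)
∃-true⊎∀-false {zero} p with p [] in p[]
... | true  = inj₁ ([] , p[])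
... | false = inj₂ λ { [] → p[] }
∃-true⊎∀-false {suc n} p with ∃-true⊎∀-false (p ∘ (true ∷_)) | ∃-true⊎∀-false (p ∘ (false ∷_))
... | inj₁ (x , px) | _             = inj₁ (true ∷ x , px)
... | inj₂ _        | inj₁ (x , px) = inj₁ (false ∷ x , px)
... | inj₂ none₁    | inj₂ none₀    = inj₂ λ { (true ∷ x) → none₁ x ; (false ∷ x) → none₀ x }

_∩_ : BVec n → BVec n → BVec n
_∩_ = zipWith _∧_

unitVec : Fin n → BVec n
unitVec {suc n} zero    = true ∷ zeroVec
unitVec {suc n} (suc i) = false ∷ unitVec i

⊕-identityˡ : (x : BVec n) → zeroVec ⊕ x ≡ x
⊕-identityˡ = zipWith-identityˡ xor-identityˡ

⊕-cancelʳ : (y x : BVec n) → (y ⊕ x) ⊕ x ≡ y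
⊕-cancelʳ []       []       = refl
⊕-cancelʳ (c ∷ y) (b ∷ x) =
  cong₂ _∷_ (trans (xor-assoc c b b) (trans (cong (c xor_) (xor-same b)) (xor-identityʳ c)))
            (⊕-cancelʳ y x)

zeroVec≼x : (x : BVec n) → zeroVec ≼ᵇ x ≡ true
zeroVec≼x []      = refl
zeroVec≼x (b ∷ x) = zeroVec≼x x

unitVec≼x : (x : BVec n) (i : Fin n) → lookup x i ≡ true → unitVec i ≼ᵇ x ≡ true
unitVec≼x (true ∷ x) zero    _  = zeroVec≼x x
unitVec≼x (b ∷ x)    (suc i) xᵢ = unitVec≼x x i xᵢ

z∩x≼x : (z x : BVec n) → (z ∩ x) ≼ᵇ x ≡ true
z∩x≼x []          []          = refl
z∩x≼x (true ∷ z)  (true ∷ x)  = z∩x≼x z x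
z∩x≼x (false ∷ z) (true ∷ x)  = z∩x≼x z x
z∩x≼x (true ∷ z)  (false ∷ x) = z∩x≼x z x
z∩x≼x (false ∷ z) (false ∷ x) = z∩x≼x z x

z≼x⊕y⇒z∩x⊕z∩y≡z : (z x y : BVec n) → z ≼ᵇ (x ⊕ y) ≡ true → (z ∩ x) ⊕ (z ∩ y) ≡ z
z≼x⊕y⇒z∩x⊕z∩y≡z []          []          []          _    = refl
z≼x⊕y⇒z∩x⊕z∩y≡z (false ∷ z) (b ∷ x)     (d ∷ y)     z≼   = cong (false ∷_) (z≼x⊕y⇒z∩x⊕z∩y≡z z x y z≼)
z≼x⊕y⇒z∩x⊕z∩y≡z (true ∷ z)  (true ∷ x)  (false ∷ y) z≼   = cong (true ∷_) (z≼x⊕y⇒z∩x⊕z∩y≡z z x y z≼)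
z≼x⊕y⇒z∩x⊕z∩y≡z (true ∷ z)  (false ∷ x) (true ∷ y)  z≼   = cong (true ∷_) (z≼x⊕y⇒z∩x⊕z∩y≡z z x y z≼)
z≼x⊕y⇒z∩x⊕z∩y≡z (true ∷ z)  (true ∷ x)  (true ∷ y)  ()
z≼x⊕y⇒z∩x⊕z∩y≡z (true ∷ z)  (false ∷ x) (false ∷ y) ()

↓_⊆_ : BVec n → BoolFun n → Set
↓ x ⊆ G = ∀ y → y ≼ᵇ x ≡ true → G y ≡ true

module _ {G : BoolFun n} where

  inX⇒G : ∀ {x} → inX G x ≡ true → G x ≡ true
  inX⇒G = ∧-conicalˡ _ _

  inX⇒↓⊆ : ∀ {x} → inX G x ≡ true → ↓ x ⊆ G
  inX⇒↓⊆ {x} x∈𝒳 y y≼x = not-injective (begin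
    not (G y)                ≡⟨ cong (_∧ not (G y)) y≼x ⟨
    (y ≼ᵇ x) ∧ not (G y)     ≡⟨ count≡0⇒false _ below∖G≡0 y ⟩
    false                    ∎)
    where
    open ≡-Reasoning
    below∖G≡0 : count (λ y → (y ≼ᵇ x) ∧ not (G y)) ≡ 0
    below∖G≡0 = n≤0⇒n≡0 (≤ᵇ-true⇒≤ (∧-conicalʳ _ _ x∈𝒳))

  ↓⊆⇒inX : ∀ {x} → G x ≡ true → ↓ x ⊆ G → inX G x ≡ true
  ↓⊆⇒inX {x} Gx ↓x⊆G =
    cong₂ _∧_ Gx (cong (_≤ᵇ 0) (countList-false _ below∖G-empty (allVecs n)))
    where
    below∖G-empty : ∀ y → (y ≼ᵇ x) ∧ not (G y) ≡ false
    below∖G-empty y with y ≼ᵇ x in y≼x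
    ... | false = refl
    ... | true  rewrite ↓x⊆G y y≼x = refl

  module _ (⊕-closed : (x y : BVec n) → G x ≡ true → G y ≡ true → G (x ⊕ y) ≡ true) where

    inX-⊕-closed : ∀ {x y} → inX G x ≡ true → inX G y ≡ true → inX G (x ⊕ y) ≡ true
    inX-⊕-closed {x} {y} x∈𝒳 y∈𝒳 = ↓⊆⇒inX (⊕-closed x y (inX⇒G x∈𝒳) (inX⇒G y∈𝒳)) λ z z≼x⊕y →
      subst (λ w → G w ≡ true) (z≼x⊕y⇒z∩x⊕z∩y≡z z x y z≼x⊕y)
        (⊕-closed (z ∩ x) (z ∩ y) (inX⇒↓⊆ x∈𝒳 _ (z∩x≼x z x)) (inX⇒↓⊆ y∈𝒳 _ (z∩x≼x z y)))

    inX-⊕-∉ : ∀ {a x} → inX G a ≡ false → inX G x ≡ true → inX G (a ⊕ x) ≡ false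
    inX-⊕-∉ {a} {x} a∉𝒳 x∈𝒳 with inX G (a ⊕ x) in a⊕x∈𝒳
    ... | false = refl
    ... | true with () ← trans (sym a∉𝒳)
                           (subst (λ w → inX G w ≡ true) (⊕-cancelʳ a x) (inX-⊕-closed a⊕x∈𝒳 x∈𝒳))

spanned-by-units : {P : BoolFun n} → IsLinearSubspace P → (x : BVec n) →
                   (∀ i → lookup x i ≡ true → P (unitVec i) ≡ true) → P x ≡ true
spanned-by-units {zero}  (P0 , _) [] _ = P0
spanned-by-units {suc n} {P} (P0 , ⊕-closed) (b ∷ x) units = with-head b units
  where
  P[false∷x] : P (false ∷ x) ≡ true
  P[false∷x] = spanned-by-units (P0 , λ y z → ⊕-closed (false ∷ y) (false ∷ z)) x (units ∘ suc)
  with-head : ∀ b → (∀ i → lookup (b ∷ x) i ≡ true → P (unitVec i) ≡ true) → P (b ∷ x) ≡ true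
  with-head false _     = P[false∷x]
  with-head true  units = subst (λ w → P (true ∷ w) ≡ true) (⊕-identityˡ x)
                            (⊕-closed (true ∷ zeroVec) (false ∷ x) (units zero refl) P[false∷x])

negConj⁺ : (S x : BVec n) → (∀ i → lookup x i ≡ true → lookup S i ≡ false) → negConj S x ≡ true
negConj⁺ []          []          _ = refl
negConj⁺ (false ∷ S) (b ∷ x)     h = negConj⁺ S x (h ∘ suc)
negConj⁺ (true ∷ S)  (false ∷ x) h = negConj⁺ S x (h ∘ suc)
negConj⁺ (true ∷ S)  (true ∷ x)  h with () ← h zero refl

negConj⁻ : (S x : BVec n) → negConj S x ≡ true → ∀ i → lookup x i ≡ true → lookup S i ≡ false
negConj⁻ (false ∷ S) (b ∷ x)     _ zero    _ = refl
negConj⁻ (false ∷ S) (b ∷ x)     h (suc i)   = negConj⁻ S x h i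
negConj⁻ (true ∷ S)  (false ∷ x) h zero    ()
negConj⁻ (true ∷ S)  (false ∷ x) h (suc i)   = negConj⁻ S x h i
negConj⁻ (true ∷ S)  (true ∷ x)  ()

downClosed⇒antiMonotoneConj : {G : BoolFun n} → IsLinearSubspace G →
                              (∀ x → G x ≡ true → ↓ x ⊆ G) → IsAntiMonotoneConj G
downClosed⇒antiMonotoneConj {n} {G} subspace down = S , λ x → ⇔true⇒≡ (G⇒negConj x) (negConj⇒G x)
  where
  S : BVec n
  S = tabulate (not ∘ G ∘ unitVec)
  G⇒negConj : ∀ x → G x ≡ true → negConj S x ≡ true
  G⇒negConj x Gx = negConj⁺ S x λ i xᵢ →
    trans (lookup∘tabulate _ i) (cong not (down x Gx (unitVec i) (unitVec≼x x i xᵢ)))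
  negConj⇒G : ∀ x → negConj S x ≡ true → G x ≡ true
  negConj⇒G x nc = spanned-by-units subspace x λ i xᵢ →
    not-injective (trans (sym (lookup∘tabulate _ i)) (negConj⁻ S x nc i xᵢ))

∃-G∖inX : {G : BoolFun n} → IsLinearSubspace G → ¬ IsAntiMonotoneConj G →
          Σ (BVec n) (λ a → G a ≡ true × inX G a ≡ false)
∃-G∖inX {G = G} subspace ¬amc with ∃-true⊎∀-false (λ a → G a ∧ not (inX G a))
... | inj₁ (a , a∈G∖𝒳) = a , ∧-conicalˡ _ _ a∈G∖𝒳 , not-injective (∧-conicalʳ _ _ a∈G∖𝒳)
... | inj₂ G∖𝒳-empty =
  ⊥-elim (¬amc (downClosed⇒antiMonotoneConj subspace λ x Gx → inX⇒↓⊆ (G⊆𝒳 x Gx)))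
  where
  G⊆𝒳 : ∀ x → G x ≡ true → inX G x ≡ true
  G⊆𝒳 x Gx = not-injective (trans (sym (cong (_∧ not (inX G x)) Gx)) (G∖𝒳-empty x))

module _ (f G : BoolFun n) where

  G∖inX∩F : BoolFun n
  G∖inX∩F x = (G x ∧ not (inX G x)) ∧ f x

  mismatch : BoolFun n
  mismatch x = f x xor G x

  module _ (⊕-closed : (x y : BVec n) → G x ≡ true → G y ≡ true → G (x ⊕ y) ≡ true) where

    F∩a⊕F-cover : ∀ {a} → G a ≡ true → inX G a ≡ false →
                          ∀ x → f x ≡ true → f (a ⊕ x) ≡ true →
                          G∖inX∩F (a ⊕ x) ∨ (G∖inX∩F x ∨ mismatch x) ≡ true
    F∩a⊕F-cover {a} Ga a∉𝒳 x fx fa⊕x with inX G x ≟ true | G x ≟ true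
    ... | yes x∈𝒳 | _ = ∨-introˡ (G∖inX∩F x ∨ mismatch x) (cong₂ _∧_
           (cong₂ _∧_ (⊕-closed a x Ga (inX⇒G {G = G} x∈𝒳)) (cong not (inX-⊕-∉ ⊕-closed a∉𝒳 x∈𝒳)))
           fa⊕x)
    ... | no x∉𝒳 | yes x∈G = ∨-introʳ (G∖inX∩F (a ⊕ x)) (∨-introˡ (mismatch x)
           (cong₂ _∧_ (cong₂ _∧_ x∈G (cong not (¬-not x∉𝒳))) fx))
    ... | no _    | no x∉G = ∨-introʳ (G∖inX∩F (a ⊕ x)) (∨-introʳ (G∖inX∩F x)
           (cong₂ _xor_ fx (¬-not x∉G)))

    count-F∩a⊕F : ∀ {a} → G a ≡ true → inX G a ≡ false →
      count (λ x → f x ∧ f (a ⊕ x)) ≤ count G∖inX∩F + (count G∖inX∩F + count mismatch)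
    count-F∩a⊕F {a} Ga a∉𝒳 = begin
      count (λ x → f x ∧ f (a ⊕ x))
        ≤⟨ countList-mono _ _ (λ x fx∧fa⊕x → F∩a⊕F-cover Ga a∉𝒳 x
             (∧-conicalˡ (f x) (f (a ⊕ x)) fx∧fa⊕x) (∧-conicalʳ (f x) (f (a ⊕ x)) fx∧fa⊕x)) (allVecs n) ⟩
      count (λ x → G∖inX∩F (a ⊕ x) ∨ (G∖inX∩F x ∨ mismatch x))
        ≤⟨ countList-∨ _ _ (allVecs n) ⟩
      count (λ x → G∖inX∩F (a ⊕ x)) + count (λ x → G∖inX∩F x ∨ mismatch x)
        ≤⟨ +-mono-≤ (≤-reflexive (count-⊕-invariant G∖inX∩F a)) (countList-∨ G∖inX∩F mismatch (allVecs n)) ⟩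
      count G∖inX∩F + (count G∖inX∩F + count mismatch)
        ∎
      where open ≤-Reasoning

lemma3p16 : (n : ℕ) (f : BoolFun n) →
    Σ (BVec n) (λ x → f x ≡ true) →
    IsLinearSubspace (g f) →
    ¬ IsAntiMonotoneConj (g f) →
    10 * count (λ x → f x xor g f x) ≤ N f →
    N f ≤ 10 * count (λ x → (g f x ∧ not (inX (g f) x)) ∧ f x)
lemma3p16 n f _ subspace@(_ , ⊕-closed) ¬amc 10E≤N with ∃-G∖inX subspace ¬amc
... | a , a∈G , a∉𝒳 = ≤-trans
  (m≤2k∧k≤2c+e∧10e≤m⇒m≤5c {c = C} {e = E} (≤ᵇ-true⇒≤ a∈G) (count-F∩a⊕F f (g f) ⊕-closed a∈G a∉𝒳) 10E≤N)
  (*-monoˡ-≤ C (m≤m+n 5 5))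
  where
  C E : ℕ
  C = count (G∖inX∩F f (g f))
  E = count (mismatch f (g f))
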